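{- A family of structures $\mathfrak{K}$ is $\mathbf{nUs}$-learnable if and only if $\mathfrak{K}$ is a solid $\Sigma^{\mathrm{inf}}_1$-partial order, i.e., $\mathrm{Th}_{\Sigma^{\mathrm{inf}}_1}(\mathcal{A})\neq\mathrm{Th}_{\Sigma^{\mathrm{inf}}_1}(\mathcal{B})$ for all distinct $\mathcal{A},\mathcal{B}\in\mathfrak{K}$, and for every $\mathcal{A}\in\mathfrak{K}$, \[\mathrm{Th}_{\Sigma^{\mathrm{inf}}_1}(\mathcal{A})\setminus\bigcup\{\mathrm{Th}_{\Sigma^{\mathrm{inf}}_1}(\mathcal{B}):\mathcal{B}\in\mathfrak{K},\ \mathrm{Th}_{\Sigma^{\mathrm{inf}}_1}(\mathcal{B})\subsetneq\mathrm{Th}_{\Sigma^{\mathrm{inf}}_1}(\mathcal{A})\}\neq\emptyset.\]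
   Context: All structures are countable, have domain $\mathbb{N}$, and are in a finite relational signature; a structure is identified with its atomic diagram in $2^{\mathbb{N}}$. $\mathcal{S}\restriction_s$ denotes the finite substructure of $\mathcal{S}$ on $\{0,\dots,s\}$. A family of structures $\mathfrak{K}$ is a countable set of pairwise nonisomorphic countable structures; $\mathrm{LD}(\mathfrak{K})$ is the set of all structures isomorphic to a member of $\mathfrak{K}$; $\mathrm{HS}(\mathfrak{K})=\{\ulcorner\mathcal{A}\urcorner:\mathcal{A}\in\mathfrak{K}\}\cup\{?\}$. A learner is an arbitrary function $\mathbf{M}$ from $\{\mathcal{S}\restriction_s:\mathcal{S}\in\mathrm{LD}(\mathfrak{K})\}$ to $\mathrm{HS}(\mathfrak{K})$. $\mathbf{M}$ $\mathbf{Ex}$-learns $\mathfrak{K}$ if for all $\mathcal{S}\in\mathrm{LD}(\mathfrak{K})$, $\mathcal{A}\in\mathfrak{K}$: $\lim_n\mathbf{M}(\mathcal{S}\restriction_n)=\ulcorner\mathcal{A}\urcorner$ iff $\mathcal{S}\cong\mathcal{A}$. $\mathbf{M}$ $\mathbf{nUs}$-learns $\mathfrak{K}$ if it $\mathbf{Ex}$-learns $\mathfrak{K}$ and for every $\mathcal{S}\cong\mathcal{A}\in\mathfrak{K}$ with $\mathcal{S}\in\mathrm{LD}(\mathfrak{K})$, once $\mathbf{M}$ outputs $\ulcorner\mathcal{A}\urcorner$ on some $\mathcal{S}\restriction_{n_0}$ it outputs $\ulcorner\mathcal{A}\urcorner$ on all $\mathcal{S}\restriction_m$, $m>n_0$.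 $\mathfrak{K}$ is $\mathbf{nUs}$-learnable if some learner $\mathbf{nUs}$-learns it. Infinitary logic: $\Sigma^{\mathrm{inf}}_1$ formulas are countable disjunctions of formulas $\exists\bar y\,\psi$ with $\psi$ finitary quantifier-free; $\mathrm{Th}_{\Sigma^{\mathrm{inf}}_1}(\mathcal{A})$ is the set of closed $\Sigma^{\mathrm{inf}}_1$ formulas true in $\mathcal{A}$. -}

module Defs where

open import Data.Nat using (ℕ; zero; suc; _≤_; _<_; _≡ᵇ_)
open import Data.Fin using (Fin; toℕ)
open import Data.Vec using (Vec; []; _∷_; map; lookup)
open import Data.List using (List; allFin; upTo; concatMap) renaming (map to lmap; [] to []ₗ; _∷_ to _∷ₗ_)
open import Data.Bool using (Bool; true; false; not; _∧_; _∨_)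
open import Data.Maybe using (Maybe; just; nothing)
open import Data.Product using (Σ; ∃; _×_; _,_)
open import Function.Bundles using (_↔_; Inverse)
open import Function.Definitions using (Injective)
open import Relation.Binary.PropositionalEquality using (_≡_; _≢_)
open import Relation.Nullary using (¬_)

record Signature : Set where
  field
    nRel  : ℕ
    arity : Fin nRel → ℕ
open Signature public

Structure : Signature → Set
Structure L = (r : Fin (nRel L)) → Vec ℕ (arity L r) → Bool

_≅_ : ∀ {L} → Structure L → Structure L → Set
_≅_ {L} A B = Σ (ℕ ↔ ℕ) λ f →
  ∀ (r : Fin (nRel L)) (v : Vec ℕ (arity L r)) → B r (map (Inverse.to f) v) ≡ A r v

-- Finite substructure S↾s on {0,…,s}, encoded canonically as data:
-- s together with, for each relation symbol, the list of truth values
-- on all tuples from {0,…,s} in a fixed (lexicographic) order.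

tuples : ℕ → (k : ℕ) → List (Vec ℕ k)
tuples s zero    = [] ∷ₗ []ₗ
tuples s (suc k) = concatMap (λ a → lmap (a ∷_) (tuples s k)) (upTo (suc s))

FinDiagram : Set
FinDiagram = ℕ × List (List Bool)

restrict : ∀ {L} → Structure L → ℕ → FinDiagram
restrict {L} S s = s , lmap (λ r → lmap (S r) (tuples s (arity L r))) (allFin (nRel L))

-- Families: countable sets of pairwise nonisomorphic structures,
-- presented by a countable index set (the index i is the name ⌜K i⌝).

record Family (L : Signature) : Set₁ where
  field
    Index     : Set
    member    : Index → Structure L
    countable : Σ (Index → ℕ) (Injective _≡_ _≡_)
    nonIso    : ∀ i j → i ≢ j → ¬ (member i ≅ member j)
open Family public

LD : ∀ {L} (K : Family L) → Structure L → Set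
LD K S = ∃ λ i → S ≅ member K i

-- hypothesis space HS(K) = names of members plus '?' (= nothing)
HS : ∀ {L} → Family L → Set
HS K = Maybe (Index K)

Learner : ∀ {L} → Family L → Set
Learner K = FinDiagram → HS K

ConvergesTo : {A : Set} → (ℕ → A) → A → Set
ConvergesTo f x = ∃ λ n₀ → ∀ n → n₀ ≤ n → f n ≡ x

ExLearns : ∀ {L} (K : Family L) → Learner K → Set
ExLearns K M = ∀ S → LD K S → ∀ i →
  (ConvergesTo (λ n → M (restrict S n)) (just i) → S ≅ member K i)
  × (S ≅ member K i → ConvergesTo (λ n → M (restrict S n)) (just i))

NUsLearns : ∀ {L} (K : Family L) → Learner K → Set
NUsLearns K M = ExLearns K M ×
  (∀ S → LD K S → ∀ i → S ≅ member K i → ∀ n₀ → M (restrict S n₀) ≡ just i →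
     ∀ m → n₀ < m → M (restrict S m) ≡ just i)

NUsLearnable : ∀ {L} → Family L → Set
NUsLearnable K = ∃ λ (M : Learner K) → NUsLearns K M

-- Σ^inf_1 sentences: countable disjunctions of ∃ȳ ψ, ψ finitary
-- quantifier-free in variables ȳ = y₀ … y_{k-1}.  A countable (possibly
-- finite or empty) disjunction is an ℕ-indexed family (pad with ff).

data QF (L : Signature) (k : ℕ) : Set where
  rel  : (r : Fin (nRel L)) → Vec (Fin k) (arity L r) → QF L k
  eq   : Fin k → Fin k → QF L k
  tt ff : QF L k
  neg  : QF L k → QF L k
  and or : QF L k → QF L k → QF L k

evalQF : ∀ {L k} → Structure L → Vec ℕ k → QF L k → Bool
evalQF A a (rel r xs) = A r (map (λ x → lookup a x) xs)
evalQF A a (eq x y)   = lookup a x ≡ᵇ lookup a y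
evalQF A a tt         = true
evalQF A a ff         = false
evalQF A a (neg φ)    = not (evalQF A a φ)
evalQF A a (and φ ψ)  = evalQF A a φ ∧ evalQF A a ψ
evalQF A a (or φ ψ)   = evalQF A a φ ∨ evalQF A a ψ

record ExSentence (L : Signature) : Set where
  constructor ∃[_]_
  field
    nvars : ℕ
    body  : QF L nvars

SigmaInf1 : Signature → Set
SigmaInf1 L = ℕ → ExSentence L

SatEx : ∀ {L} → Structure L → ExSentence L → Set
SatEx A (∃[ k ] ψ) = ∃ λ (a : Vec ℕ k) → evalQF A a ψ ≡ true

_⊨_ : ∀ {L} → Structure L → SigmaInf1 L → Set
A ⊨ φ = ∃ λ n → SatEx A (φ n)

Th : ∀ {L} → Structure L → SigmaInf1 L → Set
Th A φ = A ⊨ φ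

_⊆Th_ : ∀ {L} → Structure L → Structure L → Set
A ⊆Th B = ∀ φ → Th A φ → Th B φ

_≡Th_ : ∀ {L} → Structure L → Structure L → Set
A ≡Th B = (A ⊆Th B) × (B ⊆Th A)

_⊊Th_ : ∀ {L} → Structure L → Structure L → Set
A ⊊Th B = (A ⊆Th B) × ¬ (B ⊆Th A)

SolidΣ1PartialOrder : ∀ {L} → Family L → Set
SolidΣ1PartialOrder K =
  (∀ i j → i ≢ j → ¬ (member K i ≡Th member K j))
  × (∀ i → ∃ λ φ → Th (member K i) φ
         × (∀ j → member K j ⊊Th member K i → ¬ Th (member K j) φ))

-- (⇒) Let the learner, reading a member A itself, name A at stage n₀.  The
-- ∃-closed diagram of A ↾ n₀ holds in A.  If it also held in a member B whose
-- Σ₁ theory is contained in A's, a copy of A could be built that begins with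
-- A ↾ n₀ and then looks like a copy of B for long enough to make the learner
-- name B: a U-shape.  So this tell-tale separates A from the members
-- below it, and no two members share their theory.
--
-- (⇐) Call the member j a candidate at stage t when its separating sentence
-- φ j is witnessed by elements ≤ t and the data seen so far embeds into it.
-- The learner keeps its hypothesis while that is a candidate and otherwise
-- switches to the candidate of least code.  The true member stays a candidate
-- from some stage on; a member j that is a candidate infinitely often has the
-- true member below it satisfying φ j, so by solidity it is the true member.
-- Hence the learner converges and never abandons a correct hypothesis.

module Submission where

open import Level using (0ℓ)
open import Axiom.ExcludedMiddle using (ExcludedMiddle)
open import Axiom.DoubleNegationElimination using (em⇒dne)

open import Defs
open import Data.Bool using (Bool; true; false; not; _∧_; _∨_)
open import Data.Bool.Properties using (not-injective; T-≡)
open import Data.Empty using (⊥-elim)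
open import Data.Fin using (Fin; toℕ; fromℕ<) renaming (zero to fzero; suc to fsuc)
open import Data.Fin.Properties using (toℕ-fromℕ<; toℕ<n; toℕ-injective)
open import Data.List using (allFin) renaming (map to lmap; _∷_ to _∷ₗ_)
import Data.List.Properties as List
open import Data.List.Membership.Propositional using (_∈_)
open import Data.List.Membership.Propositional.Properties using (∈-concat⁺′; ∈-map⁺; ∈-upTo⁺; ∈-allFin)
open import Data.List.Relation.Unary.All using () renaming (All to Allₗ; [] to []ₐ; _∷_ to _∷ₐ_)
import Data.List.Relation.Unary.All as Allₗ
import Data.List.Relation.Unary.All.Properties as Allₗ
open import Data.List.Relation.Unary.Any using (here; there)
open import Data.Maybe using (Maybe; just; nothing; maybe′; _<∣>_)
open import Data.Maybe.Properties using (just-injective)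
open import Data.Nat using (ℕ; zero; suc; _≤_; _<_; _≤′_; _≟_; _≡ᵇ_; _⊔_; s≤s; ≤′-refl; ≤′-step)
open import Data.Nat.Properties
  using (≤-refl; ≤-trans; <⇒≤; ≤-pred; n<1+n; n≤1+n; m<n⇒m<1+n; m≤n⇒m<n∨m≡n; <-irrefl;
         m≤m⊔n; m≤n⊔m; m≤n⇒m≤1+n; ≤⇒≤′; ≤′⇒≤; ≡ᵇ⇒≡; ≡⇒≡ᵇ)
open import Data.Product using (Σ; ∃; _×_; _,_; proj₁; proj₂)
open import Data.Sum using (_⊎_; inj₁; inj₂; [_,_]′)
import Data.Sum
open import Data.Vec using (Vec; []; _∷_; map; lookup; tabulate)
open import Data.Vec.Properties using (map-id; map-cong; map-∘; lookup-map; lookup∘tabulate)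
open import Data.Vec.Relation.Unary.All using (All; []; _∷_; universal)
import Data.Vec.Relation.Unary.All as All
open import Data.Vec.Relation.Unary.All.Properties using (map⁺; lookup⁺)
open import Function using (_∘_; id)
open import Function.Bundles using (_⇔_; mk⇔; Equivalence; _↔_; Inverse; mk↔ₛ′)
open import Function.Definitions using (Injective)
open import Function.Properties.Inverse using (↔-refl; ↔-sym; ↔-trans)
open import Relation.Nullary using (¬_; Dec; yes; no)
open import Relation.Nullary.Decidable using (does-⇔)
open import Relation.Binary.PropositionalEquality

∧-≡-true⁻ : ∀ {b c} → b ∧ c ≡ true → b ≡ true × c ≡ true
∧-≡-true⁻ {true} e = refl , e

∧-≡-true⁺ : ∀ {b c} → b ≡ true → c ≡ true → b ∧ c ≡ true
∧-≡-true⁺ refl e = e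

≡ᵇ-true⇒≡ : ∀ {m n} → (m ≡ᵇ n) ≡ true → m ≡ n
≡ᵇ-true⇒≡ {m} {n} e = ≡ᵇ⇒≡ m n (Equivalence.from T-≡ e)

≡⇒≡ᵇ-true : ∀ {m n} → m ≡ n → (m ≡ᵇ n) ≡ true
≡⇒≡ᵇ-true {m} {n} e = Equivalence.to T-≡ (≡⇒≡ᵇ m n e)

vmax : ∀ {k} → Vec ℕ k → ℕ
vmax []       = 0
vmax (x ∷ xs) = x ⊔ vmax xs

All≤-weaken : ∀ {k m n} {v : Vec ℕ k} → m ≤ n → All (_≤ m) v → All (_≤ n) v
All≤-weaken m≤n = All.map (λ p → ≤-trans p m≤n)

All≤vmax : ∀ {k} (v : Vec ℕ k) → All (_≤ vmax v) v
All≤vmax []       = []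
All≤vmax (x ∷ xs) = m≤m⊔n x (vmax xs) ∷ All≤-weaken (m≤n⊔m x (vmax xs)) (All≤vmax xs)

↔-injective : (π : ℕ ↔ ℕ) → Injective _≡_ _≡_ (Inverse.to π)
↔-injective π {x} {y} e = begin
  x                                       ≡⟨ Inverse.strictlyInverseʳ π x ⟨
  Inverse.from π (Inverse.to π x)         ≡⟨ cong (Inverse.from π) e ⟩
  Inverse.from π (Inverse.to π y)         ≡⟨ Inverse.strictlyInverseʳ π y ⟩
  y                                       ∎
  where open ≡-Reasoning

module _ {L : Signature} where

  Agree : ℕ → Structure L → Structure L → Set
  Agree n S T = ∀ r v → All (_≤ n) v → S r v ≡ T r v

  Agree-sym : ∀ {n S T} → Agree n S T → Agree n T S
  Agree-sym ag r v p = sym (ag r v p)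

  Agree-trans : ∀ {n S T U} → Agree n S T → Agree n T U → Agree n S U
  Agree-trans ag ag′ r v p = trans (ag r v p) (ag′ r v p)

  Agree-≤ : ∀ {m n S T} → m ≤ n → Agree n S T → Agree m S T
  Agree-≤ m≤n ag r v p = ag r v (All≤-weaken m≤n p)

  ≅-refl : {A : Structure L} → A ≅ A
  ≅-refl {A} = ↔-refl , λ r v → cong (A r) (map-id v)

  ≅-sym : {A B : Structure L} → A ≅ B → B ≅ A
  ≅-sym {A} {B} (π , h) = ↔-sym π , λ r v → begin
    A r (map (Inverse.from π) v)                     ≡⟨ h r _ ⟨
    B r (map (Inverse.to π) (map (Inverse.from π) v)) ≡⟨ cong (B r) (map-∘ (Inverse.to π) (Inverse.from π) v) ⟨
    B r (map (Inverse.to π ∘ Inverse.from π) v)       ≡⟨ cong (B r) (map-cong (Inverse.strictlyInverseˡ π) v) ⟩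
    B r (map id v)                                   ≡⟨ cong (B r) (map-id v) ⟩
    B r v                                            ∎
    where open ≡-Reasoning

  infixl 30 _⟨_⟩
  _⟨_⟩ : Structure L → ℕ ↔ ℕ → Structure L
  (Y ⟨ π ⟩) r v = Y r (map (Inverse.to π) v)

  ⟨⟩-≅ : (Y : Structure L) (π : ℕ ↔ ℕ) → Y ⟨ π ⟩ ≅ Y
  ⟨⟩-≅ Y π = π , λ r v → refl

  record _↾_↪_ (X : Structure L) (n : ℕ) (Y : Structure L) : Set where
    constructor _,_
    field
      perm   : ℕ ↔ ℕ
      agrees : Agree n (Y ⟨ perm ⟩) X

  open _↾_↪_ public

  ↪-≤ : ∀ {m n X Y} → m ≤ n → X ↾ n ↪ Y → X ↾ m ↪ Y
  ↪-≤ m≤n (π , ag) = π , Agree-≤ m≤n ag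

  ↪-Agree : ∀ {n X X′ Y} → Agree n X X′ → X ↾ n ↪ Y → X′ ↾ n ↪ Y
  ↪-Agree ag (π , agπ) = π , Agree-trans agπ ag

  ≅⇒↪ : ∀ {X Y} → X ≅ Y → ∀ n → X ↾ n ↪ Y
  ≅⇒↪ (π , h) n = π , λ r v _ → h r v

  _↾_⊨_ : Structure L → ℕ → SigmaInf1 L → Set
  S ↾ t ⊨ φ = ∃ λ m → let open ExSentence (φ m) in
    Σ (Vec ℕ nvars) λ a → All (_≤ t) a × evalQF S a body ≡ true

  ↾⊨⇒⊨ : ∀ {S t φ} → S ↾ t ⊨ φ → S ⊨ φ
  ↾⊨⇒⊨ (m , a , _ , sat) = m , a , sat

  ⊨⇒↾⊨ : ∀ {S φ} → S ⊨ φ → ∃ λ t → S ↾ t ⊨ φ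
  ⊨⇒↾⊨ (m , a , sat) = vmax a , m , a , All≤vmax a , sat

  ↾⊨-≤ : ∀ {s t S φ} → s ≤ t → S ↾ s ⊨ φ → S ↾ t ⊨ φ
  ↾⊨-≤ s≤t (m , a , a≤s , sat) = m , a , All≤-weaken s≤t a≤s , sat

  evalQF-transport : ∀ {X Y : Structure L} {P : ℕ → Set} (g : ℕ → ℕ) → Injective _≡_ _≡_ g →
                     (∀ r v → All P v → Y r (map g v) ≡ X r v) →
                     ∀ {k} {a : Vec ℕ k} → All P a → (θ : QF L k) →
                     evalQF Y (map g a) θ ≡ evalQF X a θ
  evalQF-transport {X} {Y} g inj pres {a = a} Pa (rel r xs) = begin
    Y r (map (lookup (map g a)) xs)   ≡⟨ cong (Y r) (map-cong (λ x → lookup-map x g a) xs) ⟩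
    Y r (map (g ∘ lookup a) xs)       ≡⟨ cong (Y r) (map-∘ g (lookup a) xs) ⟩
    Y r (map g (map (lookup a) xs))   ≡⟨ pres r _ (map⁺ (universal (lookup⁺ Pa) xs)) ⟩
    X r (map (lookup a) xs)           ∎
    where open ≡-Reasoning
  evalQF-transport g inj pres {a = a} Pa (eq x y) rewrite lookup-map x g a | lookup-map y g a =
    does-⇔ (mk⇔ inj (cong g)) (g (lookup a x) ≟ g (lookup a y)) (lookup a x ≟ lookup a y)
  evalQF-transport g inj pres Pa tt        = refl
  evalQF-transport g inj pres Pa ff        = refl
  evalQF-transport g inj pres Pa (neg θ)   = cong not (evalQF-transport g inj pres Pa θ)
  evalQF-transport g inj pres Pa (and θ ψ) = cong₂ _∧_ (evalQF-transport g inj pres Pa θ) (evalQF-transport g inj pres Pa ψ)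
  evalQF-transport g inj pres Pa (or θ ψ)  = cong₂ _∨_ (evalQF-transport g inj pres Pa θ) (evalQF-transport g inj pres Pa ψ)

  ↾⊨-Agree : ∀ {t S S′ φ} → Agree t S S′ → S ↾ t ⊨ φ → S′ ↾ t ⊨ φ
  ↾⊨-Agree {S = S} {S′} {φ} ag (m , a , a≤t , sat) = m , a , a≤t , (begin
    evalQF S′ a θ           ≡⟨ cong (λ b → evalQF S′ b θ) (map-id a) ⟨
    evalQF S′ (map id a) θ  ≡⟨ evalQF-transport {X = S} {Y = S′} id id id-preserves a≤t θ ⟩
    evalQF S a θ            ≡⟨ sat ⟩
    true                    ∎)
    where
    open ≡-Reasoning
    θ : QF L (ExSentence.nvars (φ m))
    θ = ExSentence.body (φ m)
    id-preserves : ∀ r v → All (_≤ _) v → S′ r (map id v) ≡ S r v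
    id-preserves r v v≤t = trans (cong (S′ r) (map-id v)) (sym (ag r v v≤t))

  ↪-↾⊨ : ∀ {n X Y φ} → X ↾ n ↪ Y → X ↾ n ⊨ φ → Y ⊨ φ
  ↪-↾⊨ {X = X} {Y} {φ} (π , ag) (m , a , a≤n , sat) =
    m , map (Inverse.to π) a ,
    trans (evalQF-transport {X = X} {Y} (Inverse.to π) (↔-injective π) ag a≤n (ExSentence.body (φ m))) sat

  ⊆Th-fromFinite : ∀ {X Y} → (∀ n → X ↾ n ↪ Y) → X ⊆Th Y
  ⊆Th-fromFinite {X} {Y} emb φ X⊨φ = let t , w = ⊨⇒↾⊨ {X} {φ} X⊨φ in ↪-↾⊨ {X = X} {Y} {φ} (emb t) w

  ≅⇒⊆Th : ∀ {X Y} → X ≅ Y → X ⊆Th Y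
  ≅⇒⊆Th {X} {Y} iso = ⊆Th-fromFinite (≅⇒↪ {X} {Y} iso)

transpose : ℕ → ℕ → ℕ → ℕ
transpose p q x with x ≟ p
... | yes _ = q
... | no _ with x ≟ q
...   | yes _ = p
...   | no _  = x

transpose-ˡ : ∀ p q → transpose p q p ≡ q
transpose-ˡ p q with p ≟ p
... | yes _ = refl
... | no p≢p = ⊥-elim (p≢p refl)

transpose-ʳ : ∀ p q → transpose p q q ≡ p
transpose-ʳ p q with q ≟ p
... | yes q≡p = q≡p
... | no _ with q ≟ q
...   | yes _ = refl
...   | no q≢q = ⊥-elim (q≢q refl)

transpose-other : ∀ {p q x} → x ≢ p → x ≢ q → transpose p q x ≡ x
transpose-other {p} {q} {x} x≢p x≢q with x ≟ p
... | yes x≡p = ⊥-elim (x≢p x≡p)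
... | no _ with x ≟ q
...   | yes x≡q = ⊥-elim (x≢q x≡q)
...   | no _ = refl

transpose-involutive : ∀ p q x → transpose p q (transpose p q x) ≡ x
transpose-involutive p q x = cases (x ≟ p) (x ≟ q)
  where
  cases : Dec (x ≡ p) → Dec (x ≡ q) → transpose p q (transpose p q x) ≡ x
  cases (yes x≡p) _ =
    trans (cong (transpose p q) (trans (cong (transpose p q) x≡p) (transpose-ˡ p q))) (trans (transpose-ʳ p q) (sym x≡p))
  cases (no _) (yes x≡q) =
    trans (cong (transpose p q) (trans (cong (transpose p q) x≡q) (transpose-ʳ p q))) (trans (transpose-ˡ p q) (sym x≡q))
  cases (no x≢p) (no x≢q) =
    trans (cong (transpose p q) (transpose-other x≢p x≢q)) (transpose-other x≢p x≢q)

transposition : ℕ → ℕ → ℕ ↔ ℕ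
transposition p q = mk↔ₛ′ (transpose p q) (transpose p q) (transpose-involutive p q) (transpose-involutive p q)

InjectiveBelow : ℕ → (ℕ → ℕ) → Set
InjectiveBelow k f = ∀ {i j} → i < k → j < k → f i ≡ f j → i ≡ j

-- Stage k+1 swaps the current image of k with f k; the earlier values are
-- untouched since f is injective below k+1.
extend : (ℕ → ℕ) → ℕ → ℕ ↔ ℕ
extend f zero    = ↔-refl
extend f (suc k) = ↔-trans (extend f k) (transposition (Inverse.to (extend f k) k) (f k))

extend-agrees : ∀ f k → InjectiveBelow k f → ∀ {i} → i < k → Inverse.to (extend f k) i ≡ f i
extend-agrees f (suc k) inj {i} i<1+k with m≤n⇒m<n∨m≡n (≤-pred i<1+k)
... | inj₂ refl = transpose-ˡ (Inverse.to (extend f i) i) (f i)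
... | inj₁ i<k  = begin
  transpose (π k) (f k) (π i)   ≡⟨ cong (transpose (π k) (f k)) πi≡fi ⟩
  transpose (π k) (f k) (f i)   ≡⟨ transpose-other fi≢πk fi≢fk ⟩
  f i                           ∎
  where
  open ≡-Reasoning
  π : ℕ → ℕ
  π = Inverse.to (extend f k)
  πi≡fi : π i ≡ f i
  πi≡fi = extend-agrees f k (λ i<k j<k → inj (m<n⇒m<1+n i<k) (m<n⇒m<1+n j<k)) i<k
  fi≢πk : f i ≢ π k
  fi≢πk e = <-irrefl (↔-injective (extend f k) (trans πi≡fi e)) i<k
  fi≢fk : f i ≢ f k
  fi≢fk e = <-irrefl (inj (m<n⇒m<1+n i<k) (n<1+n k) e) i<k

literal : ∀ {L k} → Bool → QF L k → QF L k
literal true  θ = θ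
literal false θ = neg θ

⋀ : ∀ {L k} n → (Fin n → QF L k) → QF L k
⋀ zero    θ = tt
⋀ (suc n) θ = and (θ fzero) (⋀ n (θ ∘ fsuc))

⋀ᵗ : ∀ {L k} m → (Vec (Fin k) m → QF L k) → QF L k
⋀ᵗ zero    θ = θ []
⋀ᵗ {k = k} (suc m) θ = ⋀ k λ x → ⋀ᵗ m (θ ∘ (x ∷_))

module _ {L : Signature} {k : ℕ} (Y : Structure L) (a : Vec ℕ k) where

  literal⁺ : ∀ b θ → evalQF Y a θ ≡ b → evalQF Y a (literal b θ) ≡ true
  literal⁺ true  θ e = e
  literal⁺ false θ e = cong not e

  literal⁻ : ∀ b θ → evalQF Y a (literal b θ) ≡ true → evalQF Y a θ ≡ b
  literal⁻ true  θ e = e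
  literal⁻ false θ e = not-injective {y = false} e

  ⋀⁺ : ∀ n (θ : Fin n → QF L k) → (∀ x → evalQF Y a (θ x) ≡ true) → evalQF Y a (⋀ n θ) ≡ true
  ⋀⁺ zero    θ h = refl
  ⋀⁺ (suc n) θ h = ∧-≡-true⁺ (h fzero) (⋀⁺ n (θ ∘ fsuc) (h ∘ fsuc))

  ⋀⁻ : ∀ n (θ : Fin n → QF L k) → evalQF Y a (⋀ n θ) ≡ true → ∀ x → evalQF Y a (θ x) ≡ true
  ⋀⁻ (suc n) θ e fzero    = proj₁ (∧-≡-true⁻ e)
  ⋀⁻ (suc n) θ e (fsuc x) = ⋀⁻ n (θ ∘ fsuc) (proj₂ (∧-≡-true⁻ e)) x

  ⋀ᵗ⁺ : ∀ m (θ : Vec (Fin k) m → QF L k) → (∀ xs → evalQF Y a (θ xs) ≡ true) → evalQF Y a (⋀ᵗ m θ) ≡ true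
  ⋀ᵗ⁺ zero    θ h = h []
  ⋀ᵗ⁺ (suc m) θ h = ⋀⁺ k _ λ x → ⋀ᵗ⁺ m (θ ∘ (x ∷_)) (h ∘ (x ∷_))

  ⋀ᵗ⁻ : ∀ m (θ : Vec (Fin k) m → QF L k) → evalQF Y a (⋀ᵗ m θ) ≡ true → ∀ xs → evalQF Y a (θ xs) ≡ true
  ⋀ᵗ⁻ zero    θ e []       = e
  ⋀ᵗ⁻ (suc m) θ e (x ∷ xs) = ⋀ᵗ⁻ m (θ ∘ (x ∷_)) (⋀⁻ k _ e x) xs

-- Reads a tuple as a function on ℕ, with junk value 0 past its end.
entry : ∀ {k} → Vec ℕ k → ℕ → ℕ
entry []       i       = 0
entry (x ∷ xs) zero    = x
entry (x ∷ xs) (suc i) = entry xs i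

entry-lookup : ∀ {k} (a : Vec ℕ k) (x : Fin k) → entry a (toℕ x) ≡ lookup a x
entry-lookup (y ∷ a) fzero    = refl
entry-lookup (y ∷ a) (fsuc x) = entry-lookup a x

entry-fromℕ< : ∀ {k i} (a : Vec ℕ k) (i<k : i < k) → entry a i ≡ lookup a (fromℕ< i<k)
entry-fromℕ< a i<k = trans (cong (entry a) (sym (toℕ-fromℕ< i<k))) (entry-lookup a (fromℕ< i<k))

All≤⇒toℕ-image : ∀ {n m} (w : Vec ℕ m) → All (_≤ n) w → ∃ λ (xs : Vec (Fin (suc n)) m) → map toℕ xs ≡ w
All≤⇒toℕ-image []      []         = [] , refl
All≤⇒toℕ-image (x ∷ w) (x≤n ∷ w≤n) with All≤⇒toℕ-image w w≤n
... | xs , refl = fromℕ< (s≤s x≤n) ∷ xs , cong (_∷ map toℕ xs) (toℕ-fromℕ< (s≤s x≤n))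

-- The ∃-closure of the atomic diagram of X ↾ n, the variable yᵢ standing for i.
module _ {L : Signature} (X : Structure L) (n : ℕ) where

  relationalLiteral : (r : Fin (nRel L)) → Vec (Fin (suc n)) (arity L r) → QF L (suc n)
  relationalLiteral r xs = literal (X r (map toℕ xs)) (rel r xs)

  relationalDiagram : Fin (nRel L) → QF L (suc n)
  relationalDiagram r = ⋀ᵗ (arity L r) (relationalLiteral r)

  equalityLiteral : Fin (suc n) → Fin (suc n) → QF L (suc n)
  equalityLiteral x y = literal (toℕ x ≡ᵇ toℕ y) (eq x y)

  equalityDiagram : Fin (suc n) → QF L (suc n)
  equalityDiagram x = ⋀ (suc n) (equalityLiteral x)

  diagram : SigmaInf1 L
  diagram _ = ∃[ suc n ] and (⋀ (nRel L) relationalDiagram) (⋀ (suc n) equalityDiagram)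

  diagram-self : X ⊨ diagram
  diagram-self = 0 , ids , ∧-≡-true⁺ relational equality
    where
    ids : Vec ℕ (suc n)
    ids = tabulate toℕ
    ids-lookup : ∀ x → lookup ids x ≡ toℕ x
    ids-lookup = lookup∘tabulate toℕ
    relational : evalQF X ids (⋀ (nRel L) relationalDiagram) ≡ true
    relational = ⋀⁺ X ids (nRel L) relationalDiagram λ r → ⋀ᵗ⁺ X ids (arity L r) (relationalLiteral r) λ xs →
      literal⁺ X ids _ (rel r xs) (cong (X r) (map-cong ids-lookup xs))
    equality : evalQF X ids (⋀ (suc n) equalityDiagram) ≡ true
    equality = ⋀⁺ X ids (suc n) equalityDiagram λ x → ⋀⁺ X ids (suc n) (equalityLiteral x) λ y →
      literal⁺ X ids _ (eq x y) (cong₂ _≡ᵇ_ (ids-lookup x) (ids-lookup y))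

  diagram-↪ : ∀ {Y} → Y ⊨ diagram → X ↾ n ↪ Y
  diagram-↪ {Y} (_ , a , sat) = π , agree
    where
    sat-parts : evalQF Y a (⋀ (nRel L) relationalDiagram) ≡ true × evalQF Y a (⋀ (suc n) equalityDiagram) ≡ true
    sat-parts = ∧-≡-true⁻ {evalQF Y a (⋀ (nRel L) relationalDiagram)} sat
    relational : ∀ r xs → Y r (map (lookup a) xs) ≡ X r (map toℕ xs)
    relational r xs = literal⁻ Y a _ (rel r xs)
      (⋀ᵗ⁻ Y a (arity L r) (relationalLiteral r) (⋀⁻ Y a (nRel L) relationalDiagram (proj₁ sat-parts) r) xs)
    equality : ∀ x y → (lookup a x ≡ᵇ lookup a y) ≡ (toℕ x ≡ᵇ toℕ y)
    equality x y = literal⁻ Y a _ (eq x y)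
      (⋀⁻ Y a (suc n) (equalityLiteral x) (⋀⁻ Y a (suc n) equalityDiagram (proj₂ sat-parts) x) y)
    lookup-injective : ∀ {x y} → lookup a x ≡ lookup a y → x ≡ y
    lookup-injective {x} {y} e = toℕ-injective (≡ᵇ-true⇒≡ (trans (sym (equality x y)) (≡⇒≡ᵇ-true e)))
    entry-injective : InjectiveBelow (suc n) (entry a)
    entry-injective i< j< e = begin
      _                ≡⟨ toℕ-fromℕ< i< ⟨
      toℕ (fromℕ< i<)  ≡⟨ cong toℕ (lookup-injective (trans (sym (entry-fromℕ< a i<)) (trans e (entry-fromℕ< a j<)))) ⟩
      toℕ (fromℕ< j<)  ≡⟨ toℕ-fromℕ< j< ⟩
      _                ∎
      where open ≡-Reasoning
    π : ℕ ↔ ℕ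
    π = extend (entry a) (suc n)
    π-lookup : ∀ x → Inverse.to π (toℕ x) ≡ lookup a x
    π-lookup x = trans (extend-agrees (entry a) (suc n) entry-injective (toℕ<n x)) (entry-lookup a x)
    agree : Agree n (Y ⟨ π ⟩) X
    agree r v v≤n with All≤⇒toℕ-image v v≤n
    ... | xs , refl = begin
      Y r (map (Inverse.to π) (map toℕ xs))   ≡⟨ cong (Y r) (map-∘ (Inverse.to π) toℕ xs) ⟨
      Y r (map (Inverse.to π ∘ toℕ) xs)       ≡⟨ cong (Y r) (map-cong π-lookup xs) ⟩
      Y r (map (lookup a) xs)                 ≡⟨ relational r xs ⟩
      X r (map toℕ xs)                        ∎
      where open ≡-Reasoning

tuples-bounded : ∀ n k → Allₗ (All (_≤ n)) (tuples n k)
tuples-bounded n zero    = [] ∷ₐ []ₐ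
tuples-bounded n (suc k) = Allₗ.concat⁺ (Allₗ.map⁺ (Allₗ.applyUpTo⁺₁ id (suc n) λ i<1+n →
  Allₗ.map⁺ (Allₗ.map (≤-pred i<1+n ∷_) (tuples-bounded n k))))

tuples-complete : ∀ n k {v : Vec ℕ k} → All (_≤ n) v → v ∈ tuples n k
tuples-complete n zero    []          = here refl
tuples-complete n (suc k) {x ∷ v} (x≤n ∷ v≤n) =
  ∈-concat⁺′ (∈-map⁺ (x ∷_) (tuples-complete n k v≤n))
             (∈-map⁺ (λ y → lmap (y ∷_) (tuples n k)) (∈-upTo⁺ (s≤s x≤n)))

map≡map⇒≡ : ∀ {A B : Set} {f g : A → B} {xs x} → lmap f xs ≡ lmap g xs → x ∈ xs → f x ≡ g x
map≡map⇒≡ {xs = _ ∷ₗ _} e (here refl) = proj₁ (List.∷-injective e)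
map≡map⇒≡ {xs = _ ∷ₗ _} e (there x∈) = map≡map⇒≡ (proj₂ (List.∷-injective e)) x∈

module _ {L : Signature} where

  Agree⇒restrict≡ : ∀ {n} {S T : Structure L} → Agree n S T → restrict S n ≡ restrict T n
  Agree⇒restrict≡ {n} ag = cong (n ,_) (List.map-cong (λ r →
    List.map-cong-local (Allₗ.map (ag r _) (tuples-bounded n (arity L r)))) (allFin _))

  restrict≡⇒Agree : ∀ {n} {S T : Structure L} → restrict S n ≡ restrict T n → Agree n S T
  restrict≡⇒Agree {n} e r v v≤n = map≡map⇒≡ (map≡map⇒≡ (cong proj₂ e) (∈-allFin r)) (tuples-complete n _ v≤n)

-- Non-U-shaped learnability implies solidity

module _ {L : Signature} {K : Family L} (M : Learner K) (learns : NUsLearns K M) where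

  lockingStage : ∀ a → ∃ λ n → M (restrict (member K a) n) ≡ just a
  lockingStage a = let n , conv = proj₂ (proj₁ learns (member K a) (a , ≅-refl) a) ≅-refl in n , conv n ≤-refl

  tellTale : Index K → SigmaInf1 L
  tellTale a = diagram (member K a) (proj₁ (lockingStage a))

  tellTale-self : ∀ a → member K a ⊨ tellTale a
  tellTale-self a = diagram-self (member K a) (proj₁ (lockingStage a))

  -- A copy T of B extends A ↾ n₀, and M settles on b along T by some n₁ > n₀.
  -- As B ⊆Th A, a copy S of A extends T ↾ n₁.  Along S, M says a at n₀, hence
  -- (being non-U-shaped) still at n₁, where it sees exactly T ↾ n₁ and says b.
  tellTale-pins : ∀ {a b} → member K b ⊨ tellTale a → member K b ⊆Th member K a → a ≡ b
  tellTale-pins {a} {b} B⊨tellTale B⊆A = just-injective (trans (sym M-S-a) M-S-b)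
    where
    A B : Structure L
    A = member K a
    B = member K b
    n₀ : ℕ
    n₀ = proj₁ (lockingStage a)
    A↪B : A ↾ n₀ ↪ B
    A↪B = diagram-↪ A n₀ B⊨tellTale
    T : Structure L
    T = B ⟨ perm A↪B ⟩
    T-converges : ConvergesTo (λ n → M (restrict T n)) (just b)
    T-converges = proj₂ (proj₁ learns T (b , ⟨⟩-≅ B (perm A↪B)) b) (⟨⟩-≅ B (perm A↪B))
    n₁ : ℕ
    n₁ = proj₁ T-converges ⊔ suc n₀
    n₀<n₁ : n₀ < n₁
    n₀<n₁ = m≤n⊔m (proj₁ T-converges) (suc n₀)
    T↪A : T ↾ n₁ ↪ A
    T↪A = diagram-↪ T n₁ (B⊆A (diagram T n₁)
            (≅⇒⊆Th (⟨⟩-≅ B (perm A↪B)) (diagram T n₁) (diagram-self T n₁)))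
    S : Structure L
    S = A ⟨ perm T↪A ⟩
    M-S-a : M (restrict S n₁) ≡ just a
    M-S-a = proj₂ learns S (a , ⟨⟩-≅ A (perm T↪A)) a (⟨⟩-≅ A (perm T↪A)) n₀
      (trans (cong M (Agree⇒restrict≡ (Agree-trans (Agree-≤ (<⇒≤ n₀<n₁) (agrees T↪A)) (agrees A↪B))))
             (proj₂ (lockingStage a)))
      n₁ n₀<n₁
    M-S-b : M (restrict S n₁) ≡ just b
    M-S-b = trans (cong M (Agree⇒restrict≡ (agrees T↪A))) (proj₂ T-converges n₁ (m≤m⊔n _ _))

  nUsLearns⇒solid : SolidΣ1PartialOrder K
  nUsLearns⇒solid = distinct , separated
    where
    distinct : ∀ i j → i ≢ j → ¬ (member K i ≡Th member K j)
    distinct i j i≢j (i⊆j , j⊆i) = i≢j (tellTale-pins (i⊆j (tellTale i) (tellTale-self i)) j⊆i)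
    separated : ∀ i → ∃ λ φ → Th (member K i) φ × (∀ j → member K j ⊊Th member K i → ¬ Th (member K j) φ)
    separated i = tellTale i , tellTale-self i , λ j (j⊆i , i⊈j) j⊨tellTale →
      i⊈j (subst (λ k → member K i ⊆Th member K k) (tellTale-pins j⊨tellTale j⊆i) (λ φ i⊨φ → i⊨φ))

Eventually : (ℕ → Set) → Set
Eventually P = ∃ λ N → ∀ t → N ≤ t → P t

Eventually-∧ : ∀ {P Q : ℕ → Set} → Eventually P → Eventually Q → Eventually (λ t → P t × Q t)
Eventually-∧ (M , p) (N , q) = M ⊔ N , λ t le → p t (≤-trans (m≤m⊔n M N) le) , q t (≤-trans (m≤n⊔m M N) le)

Eventually-below : ∀ {Q : ℕ → ℕ → Set} → (∀ n → Eventually (Q n)) →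
                   ∀ m → Eventually (λ t → ∀ n → n < m → Q n t)
Eventually-below ev zero    = 0 , λ t _ n ()
Eventually-below {Q} ev (suc m) with Eventually-∧ (Eventually-below ev m) (ev m)
... | N , h = N , λ t N≤t n n<1+m → below-or-at (h t N≤t) (m≤n⇒m<n∨m≡n (≤-pred n<1+m))
  where
  below-or-at : ∀ {n t} → (∀ n → n < m → Q n t) × Q m t → n < m ⊎ n ≡ m → Q n t
  below-or-at (below , _) (inj₁ n<m)  = below _ n<m
  below-or-at (_ , at-m)  (inj₂ refl) = at-m

ConvergesTo-unique : ∀ {A : Set} {f : ℕ → A} {x y} → ConvergesTo f x → ConvergesTo f y → x ≡ y
ConvergesTo-unique (M , fx) (N , fy) = trans (sym (fx (M ⊔ N) (m≤m⊔n M N))) (fy (M ⊔ N) (m≤n⊔m M N))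

induction-from : ∀ {P : ℕ → Set} {b} → P b → (∀ t → b ≤ t → P t → P (suc t)) → ∀ t → b ≤ t → P t
induction-from {P} {b} Pb step t b≤t = go t (≤⇒≤′ b≤t)
  where
  go : ∀ t → b ≤′ t → P t
  go _       ≤′-refl          = Pb
  go (suc t) (≤′-step b≤′t) = step t (≤′⇒≤ b≤′t) (go t b≤′t)

firstJust : {A : Set} → (ℕ → Maybe A) → ℕ → Maybe A
firstJust f zero    = nothing
firstJust f (suc n) = firstJust f n <∣> f n

module _ {A : Set} (f : ℕ → Maybe A) where

  firstJust-sound : ∀ n {x} → firstJust f n ≡ just x → ∃ λ m → f m ≡ just x
  firstJust-sound (suc n) e with firstJust f n in e′
  ... | just _  = firstJust-sound n (trans e′ e)
  ... | nothing = n , e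

  firstJust-nothing : ∀ n → (∀ m → m < n → f m ≡ nothing) → firstJust f n ≡ nothing
  firstJust-nothing zero    _    = refl
  firstJust-nothing (suc n) none rewrite firstJust-nothing n (λ m m<n → none m (m<n⇒m<1+n m<n)) = none n (n<1+n n)

  firstJust-first : ∀ n {k x} → k < n → (∀ m → m < k → f m ≡ nothing) → f k ≡ just x → firstJust f n ≡ just x
  firstJust-first (suc n) {k} k<1+n none fk with m≤n⇒m<n∨m≡n (≤-pred k<1+n)
  ... | inj₁ k<n  rewrite firstJust-first n k<n none fk = refl
  ... | inj₂ refl rewrite firstJust-nothing k none = fk

firstJust-cong : ∀ {A : Set} {f g : ℕ → Maybe A} → f ≗ g → ∀ n → firstJust f n ≡ firstJust g n
firstJust-cong f≗g zero    = refl
firstJust-cong f≗g (suc n) = cong₂ _<∣>_ (firstJust-cong f≗g n) (f≗g n)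

-- slot t n is the index of code n if that index is a candidate at stage t.
module Locking {I : Set} (code : I → ℕ) where

  Slots : Set
  Slots = ℕ → ℕ → Maybe I

  least : Slots → ℕ → Maybe I
  least slot t = firstJust (slot t) (suc t)

  step : Slots → Maybe I → ℕ → Maybe I
  step slot nothing  t = least slot t
  step slot (just i) t = maybe′ (λ _ → just i) (least slot t) (slot t (code i))

  run : Slots → ℕ → Maybe I
  run slot zero    = least slot zero
  run slot (suc t) = step slot (run slot t) (suc t)

  step-least-or-stays : ∀ slot m t → step slot m t ≡ least slot t ⊎ step slot m t ≡ m
  step-least-or-stays slot nothing  t = inj₁ refl
  step-least-or-stays slot (just i) t with slot t (code i)
  ... | just _  = inj₂ refl
  ... | nothing = inj₁ refl

  run-cong : ∀ {slot slot′} s → (∀ t → t ≤ s → slot t ≗ slot′ t) → run slot s ≡ run slot′ s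
  run-cong zero    same = firstJust-cong (same 0 ≤-refl) 1
  run-cong {slot} {slot′} (suc s) same =
    trans (cong (λ m → step slot m (suc s)) (run-cong s (λ t t≤s → same t (m≤n⇒m≤1+n t≤s))))
          (step-cong (run slot′ s))
    where
    step-cong : ∀ m → step slot m (suc s) ≡ step slot′ m (suc s)
    step-cong nothing  = firstJust-cong (same (suc s) ≤-refl) (suc (suc s))
    step-cong (just i) = cong₂ (maybe′ (λ _ → just i)) (firstJust-cong (same (suc s) ≤-refl) (suc (suc s)))
                               (same (suc s) ≤-refl (code i))

  module Classical (em : ExcludedMiddle 0ℓ) (code-injective : Injective _≡_ _≡_ code) where

    slots : (I → ℕ → Set) → Slots
    slots Cand t n with em {∃ λ j → code j ≡ n × Cand j t}
    ... | yes (j , _) = just j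
    ... | no _        = nothing

    module _ (Cand : I → ℕ → Set) where

      slots-sound : ∀ {t n j} → slots Cand t n ≡ just j → code j ≡ n × Cand j t
      slots-sound {t} {n} e with em {∃ λ j → code j ≡ n × Cand j t}
      slots-sound refl | yes (_ , cj≡n , c) = cj≡n , c

      slots-complete : ∀ {t j} → Cand j t → slots Cand t (code j) ≡ just j
      slots-complete {t} {j} c with em {∃ λ i → code i ≡ code j × Cand i t}
      ... | yes (i , ci≡cj , _) = cong just (code-injective ci≡cj)
      ... | no ∄              = ⊥-elim (∄ (j , refl , c))

      least-sound : ∀ {t j} → least (slots Cand) t ≡ just j → Cand j t
      least-sound {t} e = proj₂ (slots-sound (proj₂ (firstJust-sound (slots Cand t) (suc t) e)))

      least-minimal : ∀ {t a} → Cand a t → code a ≤ t → (∀ j → code j < code a → ¬ Cand j t) →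
                      least (slots Cand) t ≡ just a
      least-minimal {t} {a} c ca≤t lower-fail =
        firstJust-first (slots Cand t) (suc t) (s≤s ca≤t) empty-below (slots-complete c)
        where
        empty-below : ∀ m → m < code a → slots Cand t m ≡ nothing
        empty-below m m<ca with slots Cand t m in e
        ... | nothing = refl
        ... | just j  = let cj≡m , cj = slots-sound e in ⊥-elim (lower-fail j (subst (_< code a) (sym cj≡m) m<ca) cj)

      step-keeps : ∀ {t i} → Cand i t → step (slots Cand) (just i) t ≡ just i
      step-keeps c rewrite slots-complete c = refl

      step-sound : ∀ m {t j} → step (slots Cand) m t ≡ just j → Cand j t
      step-sound nothing e = least-sound e
      step-sound (just i) {t} e with slots Cand t (code i) in e′
      ... | nothing = least-sound e
      ... | just i′ with refl ← e = let ci′≡ci , c = slots-sound e′ in subst (λ k → Cand k t) (code-injective ci′≡ci) c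

      run-sound : ∀ {t j} → run (slots Cand) t ≡ just j → Cand j t
      run-sound {zero}  e = least-sound e
      run-sound {suc t} e = step-sound (run (slots Cand) t) e

    slots-cong : ∀ {Cand Cand′ : I → ℕ → Set} {t} → (∀ j → Cand j t ⇔ Cand′ j t) → slots Cand t ≗ slots Cand′ t
    slots-cong {Cand} {Cand′} {t} equiv n with slots Cand t n in e | slots Cand′ t n in e′
    ... | nothing | nothing = refl
    ... | just j  | just j′ =
      cong just (code-injective (trans (proj₁ (slots-sound Cand e)) (sym (proj₁ (slots-sound Cand′ e′)))))
    ... | just j  | nothing
      with () ← trans (sym (slots-complete Cand′ (Equivalence.to (equiv j) (proj₂ (slots-sound Cand e)))))
                      (trans (cong (slots Cand′ t) (proj₁ (slots-sound Cand e))) e′)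
    ... | nothing | just j′
      with () ← trans (sym (slots-complete Cand (Equivalence.from (equiv j′) (proj₂ (slots-sound Cand′ e′)))))
                      (trans (cong (slots Cand t) (proj₁ (slots-sound Cand′ e′))) e)

    module _ (Cand : I → ℕ → Set) (a : I)
             (Cand-a-persists : ∀ t → Cand a t → Cand a (suc t))
             (others-fail : ∀ j → j ≢ a → Eventually (λ t → ¬ Cand j t)) where

      private
        out : ℕ → Maybe I
        out = run (slots Cand)

      out-stays : ∀ {t} → out t ≡ just a → ∀ t′ → t ≤ t′ → out t′ ≡ just a
      out-stays e = induction-from e λ t _ out-t≡a →
        trans (cong (λ m → step (slots Cand) m (suc t)) out-t≡a)
              (step-keeps Cand (Cand-a-persists t (run-sound Cand out-t≡a)))

      lower-codes-fail : Eventually (λ t → ∀ j → code j < code a → ¬ Cand j t)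
      lower-codes-fail with Eventually-below code-fails (code a)
        where
        code-fails : ∀ n → Eventually (λ t → ∀ j → code j ≡ n → j ≢ a → ¬ Cand j t)
        code-fails n with em {∃ λ j → code j ≡ n × j ≢ a}
        ... | yes (j , cj≡n , j≢a) = let N , fails = others-fail j j≢a in
          N , λ t N≤t j′ cj′≡n _ →
            subst (λ k → ¬ Cand k t) (code-injective (trans cj≡n (sym cj′≡n))) (fails t N≤t)
        ... | no ∄ = 0 , λ t _ j cj≡n j≢a → ⊥-elim (∄ (j , cj≡n , j≢a))
      ... | N , fail = N , λ t N≤t j cj<ca → fail t N≤t (code j) cj<ca j refl λ { refl → <-irrefl refl cj<ca }

      settles : ∃ (Cand a) → Eventually (λ t → least (slots Cand) t ≡ just a × Cand a t)
      settles (t₀ , c₀) with Eventually-∧ (t₀ , induction-from c₀ λ t _ → Cand-a-persists t) lower-codes-fail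
      ... | N , h = N ⊔ code a , λ t le →
        let c , lower = h t (≤-trans (m≤m⊔n N (code a)) le)
        in least-minimal Cand c (≤-trans (m≤n⊔m N (code a)) le) lower , c

      leaves-for-a : ∀ {N j} → (∀ t → N ≤ t → out (suc t) ≡ just a ⊎ out (suc t) ≡ out t) →
                     out N ≡ just j → j ≢ a → ∃ λ T → out T ≡ just a
      leaves-for-a {N} {j} moves out-N≡j j≢a with others-fail j j≢a
      ... | Nⱼ , j-fails with a-or-j (N ⊔ Nⱼ) (m≤m⊔n N Nⱼ)
        where
        a-or-j : ∀ t → N ≤ t → out t ≡ just a ⊎ out t ≡ just j
        a-or-j = induction-from (inj₂ out-N≡j) λ t N≤t a-or-j-at-t →
          [ inj₁ , (λ stays → Data.Sum.map (trans stays) (trans stays) a-or-j-at-t) ]′ (moves t N≤t)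
      ... | inj₁ out≡a = N ⊔ Nⱼ , out≡a
      ... | inj₂ out≡j = ⊥-elim (j-fails (N ⊔ Nⱼ) (m≤n⊔m N Nⱼ) (run-sound Cand out≡j))

      out-converges : ∃ (Cand a) → ConvergesTo out (just a)
      out-converges c₀ with settles c₀
      ... | N , settled = let T , out-T≡a = hits-a in T , out-stays out-T≡a
        where
        moves : ∀ t → N ≤ t → out (suc t) ≡ just a ⊎ out (suc t) ≡ out t
        moves t N≤t = Data.Sum.map (λ e → trans e (proj₁ (settled (suc t) (m≤n⇒m≤1+n N≤t)))) id
                                   (step-least-or-stays (slots Cand) (out t) (suc t))
        hits-a : ∃ λ T → out T ≡ just a
        hits-a with out N in out-N
        ... | nothing = suc N , trans (cong (λ m → step (slots Cand) m (suc N)) out-N)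
                                      (proj₁ (settled (suc N) (n≤1+n N)))
        ... | just j with em {j ≡ a}
        ...   | yes refl = N , out-N
        ...   | no j≢a   = leaves-for-a moves out-N j≢a

-- Solidity implies non-U-shaped learnability

module _ {L : Signature} (em : ExcludedMiddle 0ℓ) (K : Family L) (solid : SolidΣ1PartialOrder K) where

  private
    code : Index K → ℕ
    code = proj₁ (countable K)

    code-injective : Injective _≡_ _≡_ code
    code-injective = proj₂ (countable K)

    dne : ∀ {P : Set} → ¬ ¬ P → P
    dne = em⇒dne em

    φ : Index K → SigmaInf1 L
    φ i = proj₁ (proj₂ solid i)

  -- φ j separates member j from the members below it, so a member below
  -- member j that satisfies φ j has the same theory, hence is member j.
  ⊆Th-φ⇒≡ : ∀ {a j} → member K a ⊆Th member K j → member K a ⊨ φ j → a ≡ j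
  ⊆Th-φ⇒≡ {a} {j} A⊆J A⊨φj = dne λ a≢j → proj₁ solid a j a≢j (A⊆J , dne λ J⊈A →
    proj₂ (proj₂ (proj₂ solid j)) a (A⊆J , J⊈A) A⊨φj)

  Candidate : Structure L → Index K → ℕ → Set
  Candidate S j t = S ↾ t ⊨ φ j × S ↾ t ↪ member K j

  Candidate-Agree : ∀ {t S S′ j} → Agree t S S′ → Candidate S j t → Candidate S′ j t
  Candidate-Agree {S = S} {S′} {j} ag (w , emb) = ↾⊨-Agree {S = S} {S′} {φ j} ag w , ↪-Agree ag emb

  module _ {S : Structure L} {a : Index K} (S≅A : S ≅ member K a) where

    Candidate-true-persists : ∀ t → Candidate S a t → Candidate S a (suc t)
    Candidate-true-persists t (w , _) = ↾⊨-≤ {S = S} {φ a} (n≤1+n t) w , ≅⇒↪ S≅A (suc t)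

    Candidate-true-exists : ∃ (Candidate S a)
    Candidate-true-exists =
      let t , w = ⊨⇒↾⊨ {S = S} {φ = φ a} (≅⇒⊆Th (≅-sym S≅A) (φ a) (proj₁ (proj₂ (proj₂ solid a))))
      in t , w , ≅⇒↪ S≅A t

    Candidate-false-fails : ∀ j → j ≢ a → Eventually (λ t → ¬ Candidate S j t)
    Candidate-false-fails j j≢a = dne λ ¬fails → j≢a (sym (⊆Th-φ⇒≡ (A⊆J ¬fails) (A⊨φj ¬fails)))
      where
      A⊆J : ¬ Eventually (λ t → ¬ Candidate S j t) → member K a ⊆Th member K j
      A⊆J ¬fails ψ A⊨ψ =
        ⊆Th-fromFinite (λ t → dne λ ¬emb → ¬fails (t , λ t′ t≤t′ (_ , emb) → ¬emb (↪-≤ t≤t′ emb)))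
                       ψ (≅⇒⊆Th (≅-sym S≅A) ψ A⊨ψ)
      A⊨φj : ¬ Eventually (λ t → ¬ Candidate S j t) → member K a ⊨ φ j
      A⊨φj ¬fails =
        ≅⇒⊆Th S≅A (φ j) (dne λ S⊭φj → ¬fails (0 , λ t _ (w , _) → S⊭φj (↾⊨⇒⊨ {S = S} {φ = φ j} w)))

  open Locking code
  open Classical em code-injective

  private
    runOn : (d : FinDiagram) → Dec (∃ λ S → restrict S (proj₁ d) ≡ d) → Maybe (Index K)
    runOn d (yes (S , _)) = run (slots (Candidate S)) (proj₁ d)
    runOn d (no _)        = nothing

  learner : Learner K
  learner d = runOn d em

  learner-restrict : ∀ S n → learner (restrict S n) ≡ run (slots (Candidate S)) n
  learner-restrict S n = runOn-restrict em
    where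
    runOn-restrict : (dec : Dec (∃ λ S′ → restrict S′ n ≡ restrict S n)) →
                     runOn (restrict S n) dec ≡ run (slots (Candidate S)) n
    runOn-restrict (yes (S′ , e)) = run-cong n λ t t≤n → slots-cong λ j →
      let ag = Agree-≤ t≤n (restrict≡⇒Agree e)
      in mk⇔ (Candidate-Agree ag) (Candidate-Agree (Agree-sym ag))
    runOn-restrict (no ∄) = ⊥-elim (∄ (S , refl))

  learner-converges : ∀ {S a} → S ≅ member K a → ConvergesTo (λ n → learner (restrict S n)) (just a)
  learner-converges {S} {a} S≅A with out-converges (Candidate S) a
    (Candidate-true-persists S≅A) (Candidate-false-fails S≅A) (Candidate-true-exists S≅A)
  ... | T , converged = T , λ n T≤n → trans (learner-restrict S n) (converged n T≤n)

  learner-nUsLearns : NUsLearns K learner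
  learner-nUsLearns = learns , non-U-shaped
    where
    learns : ExLearns K learner
    learns S (k , S≅k) i = limit-correct , learner-converges
      where
      limit-correct : ConvergesTo (λ n → learner (restrict S n)) (just i) → S ≅ member K i
      limit-correct conv =
        subst (λ j → S ≅ member K j) (just-injective (ConvergesTo-unique (learner-converges S≅k) conv)) S≅k
    non-U-shaped : ∀ S → LD K S → ∀ i → S ≅ member K i → ∀ n₀ → learner (restrict S n₀) ≡ just i →
                   ∀ m → n₀ < m → learner (restrict S m) ≡ just i
    non-U-shaped S _ i S≅i n₀ e m n₀<m = trans (learner-restrict S m)
      (out-stays (Candidate S) i (Candidate-true-persists S≅i) (Candidate-false-fails S≅i)
        (trans (sym (learner-restrict S n₀)) e) m (<⇒≤ n₀<m))

  solid⇒nUsLearnable : NUsLearnable K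
  solid⇒nUsLearnable = learner , learner-nUsLearns

mainTheorem5 : ExcludedMiddle 0ℓ → (L : Signature) (K : Family L) →
    NUsLearnable K ⇔ SolidΣ1PartialOrder K
mainTheorem5 em L K = mk⇔ (λ (M , learns) → nUsLearns⇒solid {K = K} M learns) (solid⇒nUsLearnable em K)
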